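{- Let $\lambda\le\theta$ be infinite cardinals. Suppose there is a family $\mathcal F=\{f_\beta:\beta<\theta\}\subseteq\omega^\lambda$ such that: (a) $\mathcal F$ is unbounded in $(\omega^\lambda,\le^+)$, i.e. there is no $g\in\omega^\lambda$ with $f_\beta\le^+ g$ for all $\beta<\theta$; (b) every subfamily $\mathcal G\subseteq\mathcal F$ with $|\mathcal G|<\theta$ is bounded in $(\omega^\lambda,\le^+)$; (c) for every $E\subseteq\lambda$ with $|E|<\lambda$, the family $\mathcal F\restriction E=\{f_\beta\restriction E:\beta<\theta\}$ is bounded in $(\omega^E,\le^+)$. Then there is a $(\theta,\lambda)$-good set.
   Context: For a cardinal $\kappa$, the $\kappa$-fan $F_\kappa$ is the quotient of $\kappa\times(\omega+1)$ ($\kappa$ discrete, $\omega+1$ with the order topology) obtained by identifying all non-isolated points to a single point $\infty$. In $F_\theta\times F_\lambda$ a neighbourhood base at $(\infty,\infty)$ consists of the sets $V_g\times U_f=\{(\infty,\infty)\}\cup\{(\langle\beta,m\rangle,\langle\alpha,n\rangle): m>g(\beta),\ n>f(\alpha)\}$ for $g\in\omega^\theta$, $f\in\omega^\lambda$. For infinite cardinals $\lambda\le\theta$ and $A\subseteq(\theta\times\omega)\times(\lambda\times\omega)$ (viewed inside $F_\theta\times F_\lambda$): if $\lambda<\theta$, $A$ is $(\theta,\lambda)$-good if (a) $(\infty,\infty)\in\overline{A}$; (b) $(\infty,\infty)\notin\overline{B}$ for every $B\subseteq A$ with $|B|<\theta$; (c) for every $E\subseteq\lambda$ with $|E|<\lambda$,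 $(\infty,\infty)\notin\overline{A\cap((\theta\times\omega)\times(E\times\omega))}$. If $\lambda=\theta$, $A$ is $(\theta,\theta)$-good if (a), (b), (c) hold and also (d) for every $F\subseteq\theta$ with $|F|<\theta$, $(\infty,\infty)\notin\overline{A\cap((F\times\omega)\times(\theta\times\omega))}$. For a set $X$ and $f,g\in\omega^X$: $f\le^+g$ iff there is $k\in\omega$ such that for every $x\in X$, $f(x)\le g(x)$ or $f(x)\le k$. -}

module Defs where

open import Level using (0ℓ)
open import Data.Nat using (ℕ; _≤_; _<_)
open import Data.Product using (Σ; _×_; _,_; proj₁)
open import Data.Sum using (_⊎_)
open import Relation.Nullary using (¬_)
open import Function.Bundles using (_↣_; _⤖_)

-- Cardinals are represented by types; |X| ≤ |Y| means an injection X ↣ Y,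
-- |X| < |Y| means |X| ≤ |Y| and no injection Y ↣ X.

Subset : Set → Set₁
Subset X = X → Set

Elems : {X : Set} → Subset X → Set
Elems {X} S = Σ X S

-- |S| < |X| for a subset S of X (S ↣ X always holds via proj₁)
SmallerThan : {X : Set} → Subset X → Set
SmallerThan {X} S = ¬ (X ↣ Elems S)

Infinite : Set → Set
Infinite X = ℕ ↣ X

-- excluded middle for all small types (ambient classical metatheory, ZFC)
ExcludedMiddle : Set₁
ExcludedMiddle = (P : Set) → P ⊎ ¬ P

_≤⁺_ : {X : Set} → (X → ℕ) → (X → ℕ) → Set
_≤⁺_ {X} f g = Σ ℕ λ k → (x : X) → f x ≤ g x ⊎ f x ≤ k

Bounded : {I X : Set} → (I → X → ℕ) → Set
Bounded {I} {X} F = Σ (X → ℕ) λ g → (β : I) → F β ≤⁺ g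

-- points of (Θ × ω) × (Λ × ω), viewed inside F_Θ × F_Λ
Pt : Set → Set → Set
Pt Θ Λ = (Θ × ℕ) × (Λ × ℕ)

-- (∞,∞) ∈ closure of A: every basic nbhd V_g × U_f meets A
InClosure : {Θ Λ : Set} → Subset (Pt Θ Λ) → Set
InClosure {Θ} {Λ} A =
  (g : Θ → ℕ) (f : Λ → ℕ) →
  Σ Θ λ β → Σ ℕ λ m → Σ Λ λ α → Σ ℕ λ n →
    A ((β , m) , (α , n)) × g β < m × f α < n

_⊆_ : {X : Set} → Subset X → Subset X → Set
_⊆_ {X} B A = (x : X) → B x → A x

RestrictΛ : {Θ Λ : Set} → Subset (Pt Θ Λ) → Subset Λ → Subset (Pt Θ Λ)
RestrictΛ A E p@(_ , (α , _)) = A p × E α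

RestrictΘ : {Θ Λ : Set} → Subset (Pt Θ Λ) → Subset Θ → Subset (Pt Θ Λ)
RestrictΘ A F p@((β , _) , _) = A p × F β

-- (θ,λ)-good (for λ ≤ θ); condition (d) is demanded exactly when λ = θ,
-- i.e. when there is a bijection Θ ⤖ Λ.
Good : (Θ Λ : Set) → Subset (Pt Θ Λ) → Set₁
Good Θ Λ A =
  InClosure A
  × ((B : Subset (Pt Θ Λ)) → B ⊆ A → ¬ (Θ ↣ Elems B) → ¬ InClosure B)
  × ((E : Subset Λ) → SmallerThan E → ¬ InClosure (RestrictΛ A E))
  × (Θ ⤖ Λ → (F : Subset Θ) → SmallerThan F → ¬ InClosure (RestrictΘ A F))

{-# OPTIONS --safe #-}
module Submission where

open import Defs
open import Data.Nat using (ℕ; _≤_; _<_)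
open import Data.Nat.Properties using (≰⇒>; <⇒≱)
open import Data.Product using (Σ; proj₁; proj₂; _,_; _×_)
open import Data.Sum using (_⊎_; inj₁; inj₂)
open import Data.Empty using (⊥-elim)
open import Relation.Nullary using (¬_)
open import Relation.Binary.PropositionalEquality using (_≡_; refl)
open import Function.Bundles using (_↣_; _⤖_; mk↣)
open import Function.Construct.Composition using (_↣-∘_)

-- The good set is the "graph" A = {(⟨β, f_β(α)⟩, ⟨α, f_β(α)⟩)}.  The neighbourhood
-- V_g × U_u meets A exactly when some f_β(α) exceeds both g(β) and u(α), i.e. when
-- f_β ≤⁺ u fails with g(β) as the constant; so (∞,∞) ∈ cl A is the unboundedness of
-- the family.  Dually, a piece of A over a bounded subfamily (conditions (b) and (d))
-- or over a small set of columns (condition (c)) is kept away from (∞,∞) by the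
-- neighbourhood whose g and u are read off from the bound.

¬∀⇒∃¬ : ExcludedMiddle → {X : Set} {P : X → Set} →
        ¬ ((x : X) → P x) → Σ X (λ x → ¬ P x)
¬∀⇒∃¬ em {X} {P} ¬∀ with em (Σ X λ x → ¬ P x)
... | inj₁ witness = witness
... | inj₂ none    = ⊥-elim (¬∀ holds)
  where
  holds : (x : X) → P x
  holds x with em (P x)
  ... | inj₁ p  = p
  ... | inj₂ ¬p = ⊥-elim (none (x , ¬p))

¬≤⁺⇒escapes : ExcludedMiddle → {X : Set} {f g : X → ℕ} →
              ¬ (f ≤⁺ g) → (k : ℕ) → Σ X λ x → g x < f x × k < f x
¬≤⁺⇒escapes em {f = f} {g} f≰⁺g k with ¬∀⇒∃¬ em (λ below → f≰⁺g (k , below))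
... | x , ¬below = x , ≰⇒> (λ fx≤gx → ¬below (inj₁ fx≤gx)) , ≰⇒> (λ fx≤k → ¬below (inj₂ fx≤k))

¬Bounded⇒escapes : ExcludedMiddle → {I X : Set} {F : I → X → ℕ} →
                   ¬ Bounded F → (g : X → ℕ) → Σ I λ i → ¬ (F i ≤⁺ g)
¬Bounded⇒escapes em unbounded g = ¬∀⇒∃¬ em (λ bound → unbounded (g , bound))

extendByZero : ExcludedMiddle → {X : Set} (S : Subset X) → (Elems S → ℕ) → X → ℕ
extendByZero em S v x with em (S x)
... | inj₁ s = v (x , s)
... | inj₂ _ = 0

extendByZero-on : (em : ExcludedMiddle) {X : Set} (S : Subset X) (v : Elems S → ℕ) →
                  {x : X} → S x → Σ (S x) λ s → extendByZero em S v x ≡ v (x , s)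
extendByZero-on em S v {x} s with em (S x)
... | inj₁ s′ = s′ , refl
... | inj₂ ¬s = ⊥-elim (¬s s)

rows : {Θ Λ : Set} → Subset (Pt Θ Λ) → Subset Θ
rows {Θ} {Λ} B β = Σ ℕ λ m → Σ Λ λ α → Σ ℕ λ n → B ((β , m) , (α , n))

rows↣ : {Θ Λ : Set} (B : Subset (Pt Θ Λ)) → Elems (rows B) ↣ Elems B
rows↣ B = mk↣ {to = to} injective
  where
  to : Elems (rows B) → Elems B
  to (β , m , α , n , b) = ((β , m) , (α , n)) , b
  injective : {x y : Elems (rows B)} → to x ≡ to y → x ≡ y
  injective {β , m , α , n , b} {.β , .m , .α , .n , .b} refl = refl

Over : {Θ Λ : Set} → (Θ → Λ → Set) → Subset (Pt Θ Λ)
Over R ((β , _) , (α , _)) = R β α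

module _ {Θ Λ : Set} (f : Θ → Λ → ℕ) where

  Graph : Subset (Pt Θ Λ)
  Graph ((β , m) , (α , n)) = m ≡ f β α × n ≡ f β α

  Separates : (Θ → ℕ) → (Λ → ℕ) → (Θ → Λ → Set) → Set
  Separates g u R = (β : Θ) (α : Λ) → R β α → f β α ≤ g β ⊎ f β α ≤ u α

  Separable : (Θ → Λ → Set) → Set
  Separable R = Σ (Θ → ℕ) λ g → Σ (Λ → ℕ) λ u → Separates g u R

  unbounded⇒InClosure : ExcludedMiddle → ¬ Bounded f → InClosure Graph
  unbounded⇒InClosure em unbounded g u with ¬Bounded⇒escapes em unbounded u
  ... | β , fβ≰⁺u with ¬≤⁺⇒escapes em fβ≰⁺u (g β)
  ...   | α , u<f , g<f = β , f β α , α , f β α , (refl , refl) , g<f , u<f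

  separable⇒¬InClosure : {R : Θ → Λ → Set} → Separable R →
                         (C : Subset (Pt Θ Λ)) → C ⊆ Graph → C ⊆ Over R → ¬ InClosure C
  separable⇒¬InClosure (g , u , separates) C C⊆Graph C⊆R closure
    with closure g u
  ... | β , m , α , n , c , g<m , u<n
    with C⊆Graph _ c | separates β α (C⊆R _ c)
  ... | refl , refl | inj₁ f≤g = <⇒≱ g<m f≤g
  ... | refl , refl | inj₂ f≤u = <⇒≱ u<n f≤u

  boundedRows⇒separable : ExcludedMiddle → (S : Subset Θ) →
                          Bounded {Elems S} {Λ} (λ s → f (proj₁ s)) →
                          Separable (λ β _ → S β)
  boundedRows⇒separable em S (u , bound) = g , u , separates
    where
    g : Θ → ℕ
    g = extendByZero em S (λ s → proj₁ (bound s))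
    separates : Separates g u (λ β _ → S β)
    separates β α s with extendByZero-on em S (λ s → proj₁ (bound s)) s
    ... | s′ , gβ≡k with proj₂ (bound (β , s′)) α
    ...   | inj₁ f≤u = inj₂ f≤u
    ...   | inj₂ f≤k rewrite gβ≡k = inj₁ f≤k

  boundedColumns⇒separable : ExcludedMiddle → (E : Subset Λ) →
                             Bounded {Θ} {Elems E} (λ β e → f β (proj₁ e)) →
                             Separable (λ _ α → E α)
  boundedColumns⇒separable em E (v , bound) = g , u , separates
    where
    g : Θ → ℕ
    g β = proj₁ (bound β)
    u : Λ → ℕ
    u = extendByZero em E v
    separates : Separates g u (λ _ α → E α)
    separates β α e with extendByZero-on em E v e
    ... | e′ , uα≡v with proj₂ (bound β) (α , e′)
    ...   | inj₂ f≤k = inj₁ f≤k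
    ...   | inj₁ f≤v rewrite uα≡v = inj₂ f≤v

mainTheorem1 : ExcludedMiddle →
    (Θ Λ : Set) → Infinite Λ → Infinite Θ → Λ ↣ Θ →
    (f : Θ → Λ → ℕ) →
    ¬ Bounded f →
    ((S : Subset Θ) → SmallerThan S → Bounded {Elems S} {Λ} (λ s → f (proj₁ s))) →
    ((E : Subset Λ) → SmallerThan E → Bounded {Θ} {Elems E} (λ β e → f β (proj₁ e))) →
    Σ (Subset (Pt Θ Λ)) (Good Θ Λ)
mainTheorem1 em Θ Λ _ _ _ f unbounded smallRowsBounded smallColumnsBounded =
  Graph f , unbounded⇒InClosure f em unbounded , smallSubsets , smallColumns , smallRows
  where
  rowsSeparable : (S : Subset Θ) → SmallerThan S → Separable f (λ β _ → S β)
  rowsSeparable S small = boundedRows⇒separable f em S (smallRowsBounded S small)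

  smallSubsets : (B : Subset (Pt Θ Λ)) → B ⊆ Graph f → ¬ (Θ ↣ Elems B) → ¬ InClosure B
  smallSubsets B B⊆Graph small =
    separable⇒¬InClosure f (rowsSeparable (rows B) (λ Θ↣ → small (rows↣ B ↣-∘ Θ↣)))
      B B⊆Graph (λ { _ b → _ , _ , _ , b })

  smallColumns : (E : Subset Λ) → SmallerThan E → ¬ InClosure (RestrictΛ (Graph f) E)
  smallColumns E small =
    separable⇒¬InClosure f (boundedColumns⇒separable f em E (smallColumnsBounded E small))
      (RestrictΛ (Graph f) E) (λ _ → proj₁) (λ _ → proj₂)

  smallRows : Θ ⤖ Λ → (F : Subset Θ) → SmallerThan F → ¬ InClosure (RestrictΘ (Graph f) F)
  smallRows _ F small =
    separable⇒¬InClosure f (rowsSeparable F small)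
      (RestrictΘ (Graph f) F) (λ _ → proj₁) (λ _ → proj₂)
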